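{- If a vertex is reachable from a pebble distribution $p$ on a simple graph $G$, then it is also reachable from $p$ by an executable rubbling sequence in which no move of the form $(v,a\to u)$ is followed by a move of the form $(u,b\to v)$.
   Context: A pebble distribution on $G$ is a function $p:V(G)\to\mathbb{Z}_{\ge0}$. If $\{v,u\}\in E(G)$, the pebbling move $(v,v\to u)$ removes two pebbles at $v$ and adds one at $u$. If $v\ne w$ and $\{v,u\},\{w,u\}\in E(G)$, the strict rubbling move $(v,w\to u)$ removes one pebble at each of $v$ and $w$ and adds one at $u$. A rubbling move is either of these; $(v,w\to u)=(w,v\to u)$. A rubbling sequence is executable from $p$ if the pebble counts stay nonnegative after each move. A vertex $x$ is reachable from $p$ if some executable rubbling sequence ends with at least one pebble on $x$. -}

module Defs where

open import Data.Nat using (ℕ; zero; suc; _+_; _∸_; _≥_; _>_)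
open import Data.Fin using (Fin)
open import Data.Fin.Properties using (_≟_)
open import Data.List using (List; []; _∷_)
open import Data.List.Relation.Unary.All using (All)
open import Data.Product using (_×_; Σ; ∃; ∃-syntax; _,_)
open import Data.Sum using (_⊎_)
open import Relation.Nullary using (¬_; yes; no)
open import Relation.Binary.PropositionalEquality using (_≡_; _≢_)

record Graph (n : ℕ) : Set₁ where
  field
    Adj     : Fin n → Fin n → Set
    symm    : ∀ {x y} → Adj x y → Adj y x
    irrefl  : ∀ {x} → ¬ Adj x x

Distribution : ℕ → Set
Distribution n = Fin n → ℕ

-- A rubbling move (v , w → u): if v ≡ w it is the pebbling move (v,v→u)
-- requiring {v,u} ∈ E; if v ≢ w it is a strict rubbling move requiring
-- {v,u},{w,u} ∈ E.
record Move {n : ℕ} (G : Graph n) : Set where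
  constructor mv
  field
    src₁ src₂ tgt : Fin n
    adj₁ : Graph.Adj G src₁ tgt
    adj₂ : Graph.Adj G src₂ tgt

[_≡?_] : {n : ℕ} → Fin n → Fin n → ℕ
[ x ≡? y ] with x ≟ y
... | yes _ = 1
... | no _  = 0

-- Effect of a move: remove one pebble at each of v and w (two at v if v ≡ w),
-- add one at u.  Only applied when executable, so truncated ∸ is harmless.
apply : {n : ℕ} {G : Graph n} → Move G → Distribution n → Distribution n
apply (mv v w u _ _) p x = (p x ∸ ([ v ≡? x ] + [ w ≡? x ])) + [ u ≡? x ]

Executable : {n : ℕ} {G : Graph n} → Move G → Distribution n → Set
Executable (mv v w u _ _) p = ∀ x → p x ≥ [ v ≡? x ] + [ w ≡? x ]

data Runs {n : ℕ} {G : Graph n} : Distribution n → List (Move G) → Distribution n → Set where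
  done : ∀ {p} → Runs p [] p
  step : ∀ {p q} (m : Move G) {ms} → Executable m p → Runs (apply m p) ms q → Runs p (m ∷ ms) q

Reachable : {n : ℕ} (G : Graph n) → Distribution n → Fin n → Set
Reachable G p x = ∃[ ms ] ∃[ q ] (Runs {G = G} p ms q × q x > 0)

-- m₁ has the form (v, a → u) and m₂ has the form (u, b → v), for some v, u, a, b
-- (recall (v,a→u) = (a,v→u)).
IsSource : {n : ℕ} {G : Graph n} → Fin n → Move G → Set
IsSource x m = Move.src₁ m ≡ x ⊎ Move.src₂ m ≡ x

Reverses : {n : ℕ} {G : Graph n} → Move G → Move G → Set
Reverses m₁ m₂ = IsSource (Move.tgt m₁) m₂ × IsSource (Move.tgt m₂) m₁

data NoReversal {n : ℕ} {G : Graph n} : List (Move G) → Set where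
  []  : NoReversal []
  _∷_ : ∀ {m ms} → All (λ m' → ¬ Reverses m m') ms → NoReversal ms → NoReversal (m ∷ ms)

-- Forget the order of a reaching sequence and keep only its multiset M of moves.
-- For every vertex, the pebbles that M consumes plus the pebbles still wanted
-- at the end are at most the initial pebbles plus those M produces ("balance").
-- Conversely every balanced multiset can be scheduled without reversals: if some
-- move of M feeds a vertex that no move of M draws from, schedule the rest first
-- and that move last (nothing earlier draws from its target, so it reverses
-- nothing); otherwise following moves from sources to targets closes a cycle,
-- whose moves consume at least what they produce at every vertex, and deleting
-- them keeps the balance.
module Submission where

open import Defs
open import Data.Fin using (Fin; zero; suc)
open import Data.Fin.Properties using (_≟_; injective⇒≤)
open import Data.List using (List; []; _∷_; _++_; map; length; lookup)
import Data.List.Membership.DecPropositional as DecMembership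
open import Data.List.Membership.Propositional using (_∈_; _─_; find)
open import Data.List.Membership.Propositional.Properties using (∈-lookup)
open import Data.List.Properties using (length-removeAt′)
open import Data.List.Relation.Binary.Subset.Propositional using (_⊆_)
open import Data.List.Relation.Binary.Subset.Propositional.Properties
  using (⊆-refl; ⊆-trans; ∷⁺ʳ; All-resp-⊇)
open import Data.List.Relation.Unary.All as All using (All; []; _∷_)
open import Data.List.Relation.Unary.All.Properties using (¬Any⇒All¬; ++⁺)
open import Data.List.Relation.Unary.AllPairs using ([]; _∷_)
open import Data.List.Relation.Unary.Any using (here; there; any?; index)
open import Data.List.Relation.Unary.Unique.Propositional using (Unique)
open import Data.Nat as ℕ using (ℕ; zero; suc; _+_; _∸_; _≤_; _<_; _>_; z≤n; z<s)
open import Data.Nat.Induction using (<-wellFounded)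
open import Data.Nat.ListAction using (sum)
open import Data.Nat.Properties hiding (_≟_)
open import Algebra.Properties.CommutativeSemigroup +-commutativeSemigroup
  using (x∙yz≈y∙xz; xy∙z≈xz∙y)
open import Data.Nat.Tactic.RingSolver using (solve-∀)
open import Data.Product using (_×_; _,_; ∃-syntax)
open import Data.Sum using (inj₁; inj₂)
open import Function.Definitions using (Injective)
open import Induction.WellFounded using (Acc; acc)
open import Relation.Binary.PropositionalEquality
open import Relation.Nullary using (¬_; yes; no; contradiction)

module _ {A : Set} where

  sum-map-─ : (f : A → ℕ) {x : A} {xs : List A} (x∈xs : x ∈ xs) →
              sum (map f xs) ≡ f x + sum (map f (xs ─ x∈xs))
  sum-map-─ f (here refl) = refl
  sum-map-─ f {x} {y ∷ xs} (there x∈xs) = begin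
    f y + sum (map f xs)                    ≡⟨ cong (f y +_) (sum-map-─ f x∈xs) ⟩
    f y + (f x + sum (map f (xs ─ x∈xs)))   ≡⟨ x∙yz≈y∙xz (f y) (f x) _ ⟩
    f x + (f y + sum (map f (xs ─ x∈xs)))   ∎
    where open ≡-Reasoning

  ─-⊆ : {x : A} {xs : List A} (x∈xs : x ∈ xs) → xs ─ x∈xs ⊆ xs
  ─-⊆ (here refl)  y∈           = there y∈
  ─-⊆ (there x∈xs) (here refl)  = here refl
  ─-⊆ (there x∈xs) (there y∈)   = there (─-⊆ x∈xs y∈)

  ∈-─⁺ : {x y : A} {xs : List A} (x∈xs : x ∈ xs) → y ∈ xs → x ≢ y → y ∈ xs ─ x∈xs
  ∈-─⁺ (here refl)  (here refl) x≢y = contradiction refl x≢y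
  ∈-─⁺ (here refl)  (there y∈)  _   = y∈
  ∈-─⁺ (there x∈xs) (here refl) _   = here refl
  ∈-─⁺ (there x∈xs) (there y∈)  x≢y = there (∈-─⁺ x∈xs y∈ x≢y)

  length-─ : {x : A} {xs : List A} (x∈xs : x ∈ xs) → length (xs ─ x∈xs) < length xs
  length-─ {xs = xs} x∈xs = ≤-reflexive (sym (length-removeAt′ xs (index x∈xs)))

  lookup-injective : {xs : List A} → Unique xs → Injective _≡_ _≡_ (lookup xs)
  lookup-injective {_ ∷ _} _           {zero}  {zero}  _  = refl
  lookup-injective {_ ∷ _} (x∉xs ∷ _) {zero}  {suc j} eq = contradiction eq (All.lookup x∉xs (∈-lookup j))
  lookup-injective {_ ∷ _} (x∉xs ∷ _) {suc i} {zero}  eq = contradiction (sym eq) (All.lookup x∉xs (∈-lookup i))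
  lookup-injective {_ ∷ _} (_ ∷ u)     {suc i} {suc j} eq = cong suc (lookup-injective u eq)

module _ {n : ℕ} where

  unique⇒length≤ : {xs : List (Fin n)} → Unique xs → length xs ≤ n
  unique⇒length≤ u = injective⇒≤ (lookup-injective u)

  [x≡?x]≡1 : (x : Fin n) → [ x ≡? x ] ≡ 1
  [x≡?x]≡1 x with x ≟ x
  ... | yes _   = refl
  ... | no x≢x = contradiction refl x≢x

  [x≡?y]≤q : {q : Distribution n} {x : Fin n} → q x > 0 → ∀ y → [ x ≡? y ] ≤ q y
  [x≡?y]≤q {x = x} qx>0 y with x ≟ y
  ... | yes refl = qx>0
  ... | no _     = z≤n

  infixl 6 _+[_]
  _+[_] : Distribution n → Fin n → Distribution n
  (p +[ x ]) y = p y + [ x ≡? y ]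

module _ {n : ℕ} {G : Graph n} where
  open Move
  open DecMembership (_≟_ {n}) using (_∈?_)

  cost gain : Move G → Fin n → ℕ
  cost m y = [ src₁ m ≡? y ] + [ src₂ m ≡? y ]
  gain m y = [ tgt m ≡? y ]

  consumed produced : List (Move G) → Fin n → ℕ
  consumed M y = sum (map (λ m → cost m y) M)
  produced M y = sum (map (λ m → gain m y) M)

  consumed-─ : ∀ {M m} (m∈M : m ∈ M) y → consumed M y ≡ cost m y + consumed (M ─ m∈M) y
  consumed-─ m∈M y = sum-map-─ (λ m → cost m y) m∈M

  produced-─ : ∀ {M m} (m∈M : m ∈ M) y → produced M y ≡ gain m y + produced (M ─ m∈M) y
  produced-─ m∈M y = sum-map-─ (λ m → gain m y) m∈M

  [b≡?y]≤cost : ∀ {b m} → IsSource b m → ∀ y → [ b ≡? y ] ≤ cost m y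
  [b≡?y]≤cost (inj₁ refl) y = m≤m+n _ _
  [b≡?y]≤cost (inj₂ refl) y = m≤n+m _ _

  consumed-source : ∀ {M m y} → m ∈ M → IsSource y m → consumed M y > 0
  consumed-source {M} {m} {y} m∈M s = begin
    1                                ≡⟨ sym ([x≡?x]≡1 y) ⟩
    [ y ≡? y ]                       ≤⟨ [b≡?y]≤cost {m = m} s y ⟩
    cost m y                         ≤⟨ m≤m+n _ _ ⟩
    cost m y + consumed (M ─ m∈M) y  ≡⟨ sym (consumed-─ m∈M y) ⟩
    consumed M y                     ∎
    where open ≤-Reasoning

  consumed⇒source : ∀ M y → consumed M y > 0 → ∃[ m ] m ∈ M × IsSource y m
  consumed⇒source (m ∷ M) y pos with src₁ m ≟ y | src₂ m ≟ y
  ... | yes s | _     = m , here refl , inj₁ s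
  ... | no _  | yes s = m , here refl , inj₂ s
  ... | no _  | no _  with consumed⇒source M y pos
  ...   | m′ , m′∈M , s = m′ , there m′∈M , s

  Runs-conserves : ∀ {p ms q} → Runs {G = G} p ms q → ∀ y → consumed ms y + q y ≡ p y + produced ms y
  Runs-conserves {p} done y = sym (+-identityʳ (p y))
  Runs-conserves {p} {m ∷ ms} {q} (step m ex run) y = begin
    (cost m y + consumed ms y) + q y                ≡⟨ +-assoc (cost m y) _ _ ⟩
    cost m y + (consumed ms y + q y)                ≡⟨ cong (cost m y +_) (Runs-conserves run y) ⟩
    cost m y + ((p y ∸ cost m y + gain m y) + I)    ≡⟨ regroup (cost m y) (p y ∸ cost m y) (gain m y) I ⟩
    (cost m y + (p y ∸ cost m y)) + (gain m y + I)  ≡⟨ cong (_+ (gain m y + I)) (m+[n∸m]≡n (ex y)) ⟩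
    p y + (gain m y + I)                            ∎
    where
      open ≡-Reasoning
      I = produced ms y
      regroup : ∀ c r g i → c + ((r + g) + i) ≡ (c + r) + (g + i)
      regroup = solve-∀

  Balanced : Distribution n → List (Move G) → Distribution n → Set
  Balanced p M d = ∀ y → consumed M y + d y ≤ p y + produced M y

  Balanced-─ : ∀ {p M d m} → Balanced p M d → (m∈M : m ∈ M) → ∀ y →
               (cost m y + consumed (M ─ m∈M) y) + d y ≤ p y + (gain m y + produced (M ─ m∈M) y)
  Balanced-─ {p} {d = d} bal m∈M y =
    subst₂ _≤_ (cong (_+ d y) (consumed-─ m∈M y)) (cong (p y +_) (produced-─ m∈M y)) (bal y)

  Schedule : Distribution n → List (Move G) → Distribution n → Set
  Schedule p M d =
    ∃[ ms ] ∃[ q ] (Runs p ms q × NoReversal ms × (∀ y → d y ≤ q y) × All (_∈ M) ms)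

  Runs⇒Balanced : ∀ {p ms q x} → Runs {G = G} p ms q → q x > 0 → Balanced p ms (λ y → [ x ≡? y ])
  Runs⇒Balanced {q = q} run qx>0 y =
    ≤-trans (+-monoʳ-≤ _ ([x≡?y]≤q {q = q} qx>0 y)) (≤-reflexive (Runs-conserves run y))

  Schedule-⊆ : ∀ {p M M′ d} → M′ ⊆ M → Schedule p M′ d → Schedule p M d
  Schedule-⊆ M′⊆M (ms , q , run , noRev , d≤q , ms⊆M′) =
    ms , q , run , noRev , d≤q , All.map M′⊆M ms⊆M′

  Runs-snoc : ∀ {p ms q} m → Runs {G = G} p ms q → Executable m q → Runs p (ms ++ m ∷ []) (apply m q)
  Runs-snoc m done          ex = step m ex done
  Runs-snoc m (step m′ ex′ run) ex = step m′ ex′ (Runs-snoc m run ex)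

  NoReversal-snoc : ∀ {ms} m → NoReversal {G = G} ms → All (λ m′ → ¬ Reverses m′ m) ms →
                    NoReversal (ms ++ m ∷ [])
  NoReversal-snoc m []             []          = [] ∷ []
  NoReversal-snoc m (ok ∷ noRev) (¬rev ∷ ¬revs) = ++⁺ ok (¬rev ∷ []) ∷ NoReversal-snoc m noRev ¬revs

  Sink : List (Move G) → Move G → Set
  Sink M m = consumed M (tgt m) ≡ 0

  ¬Reverses-sink : ∀ {M m m′} → Sink M m → m′ ∈ M → ¬ Reverses m′ m
  ¬Reverses-sink sink m′∈M (_ , tgt-m↝m′) = <⇒≢ (consumed-source m′∈M tgt-m↝m′) (sym sink)

  -- The move m will be performed last: beforehand d must be met except for the
  -- pebble m delivers, and m's own cost must be available.
  demand-before : Move G → Distribution n → Distribution n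
  demand-before m d y = d y ∸ gain m y + cost m y

  demand-before-sufficient : ∀ {d q} m → (∀ y → demand-before m d y ≤ q y) → ∀ y → d y ≤ apply m q y
  demand-before-sufficient {d} {q} m d′≤q y = begin
    d y                        ≤⟨ m≤n+m∸n (d y) (gain m y) ⟩
    gain m y + (d y ∸ gain m y)  ≤⟨ +-monoʳ-≤ (gain m y) (m+n≤o⇒m≤o∸n _ (d′≤q y)) ⟩
    gain m y + (q y ∸ cost m y)  ≡⟨ +-comm (gain m y) _ ⟩
    apply m q y                  ∎
    where open ≤-Reasoning

  Balanced-─-sink : ∀ {p M d m} (m∈M : m ∈ M) → Sink M m → Balanced p M d →
                    Balanced p (M ─ m∈M) (demand-before m d)
  Balanced-─-sink {p} {M} {d} {m} m∈M sink bal y with tgt m ≟ y | Balanced-─ bal m∈M y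
  ... | yes refl | bal′ = begin
    O′ + (d y ∸ 1 + cost m y)  ≡⟨ cong₂ (λ o c → o + (d y ∸ 1 + c)) O′≡0 c≡0 ⟩
    d y ∸ 1 + 0                ≡⟨ +-identityʳ _ ⟩
    d y ∸ 1                    ≤⟨ ∸-monoˡ-≤ 1 (≤-trans (m≤n+m (d y) _) bal′) ⟩
    (p y + suc I′) ∸ 1         ≡⟨ cong (_∸ 1) (+-suc (p y) I′) ⟩
    p y + I′                   ∎
    where
      open ≤-Reasoning
      O′ = consumed (M ─ m∈M) y
      I′ = produced (M ─ m∈M) y
      c+O′≡0 : cost m y + O′ ≡ 0
      c+O′≡0 = trans (sym (consumed-─ m∈M y)) sink
      c≡0  = m+n≡0⇒m≡0 (cost m y) c+O′≡0
      O′≡0 = m+n≡0⇒n≡0 (cost m y) c+O′≡0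
  ... | no _ | bal′ = begin
    O′ + (d y + cost m y)   ≡⟨ regroup O′ (d y) (cost m y) ⟩
    (cost m y + O′) + d y   ≤⟨ bal′ ⟩
    p y + I′                ∎
    where
      open ≤-Reasoning
      O′ = consumed (M ─ m∈M) y
      I′ = produced (M ─ m∈M) y
      regroup : ∀ o e c → o + (e + c) ≡ (c + o) + e
      regroup = solve-∀

  Schedule-snoc : ∀ {p M d m} (m∈M : m ∈ M) → Sink M m →
                  Schedule p (M ─ m∈M) (demand-before m d) → Schedule p M d
  Schedule-snoc {M = M} {d} {m} m∈M sink (ms , q , run , noRev , d′≤q , ms⊆M′) =
    ms ++ m ∷ [] , apply m q ,
    Runs-snoc m run (λ y → ≤-trans (m≤n+m (cost m y) (d y ∸ gain m y)) (d′≤q y)) ,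
    NoReversal-snoc m noRev (All.map (¬Reverses-sink {M} {m} sink) ms⊆M) ,
    demand-before-sufficient m d′≤q ,
    ++⁺ ms⊆M (m∈M ∷ [])
    where
      ms⊆M : All (_∈ M) ms
      ms⊆M = All.map (─-⊆ m∈M) ms⊆M′

  -- Walk M a e ss steps from a vertex a to a source of some move of M feeding a;
  -- ss lists the vertices visited before reaching e.
  data Walk (M : List (Move G)) : Fin n → Fin n → List (Fin n) → Set where
    []   : ∀ {a} → Walk M a a []
    step : ∀ {m b e ss} → m ∈ M → IsSource b m → Walk M b e ss → Walk M (tgt m) e (tgt m ∷ ss)

  Cycle : List (Move G) → Set
  Cycle M = ∃[ a ] ∃[ ss ] Walk M a a (a ∷ ss) × Unique (a ∷ ss)

  Walk-─ : ∀ {M m a e ss} (m∈M : m ∈ M) → All (tgt m ≢_) ss → Walk M a e ss → Walk (M ─ m∈M) a e ss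
  Walk-─ m∈M []               []              = []
  Walk-─ m∈M (t≢ ∷ t≢s) (step m′∈M s w) =
    step (∈-─⁺ m∈M m′∈M (λ m≡m′ → t≢ (cong tgt m≡m′))) s (Walk-─ m∈M t≢s w)

  Balanced-shift : ∀ {p M d m b} (m∈M : m ∈ M) → IsSource b m →
                   Balanced p M (d +[ tgt m ]) → Balanced p (M ─ m∈M) (d +[ b ])
  Balanced-shift {p} {M} {d} {m} {b} m∈M b↝m bal y = +-cancelʳ-≤ T _ _ (begin
    (O′ + (d y + [ b ≡? y ])) + T  ≤⟨ +-monoˡ-≤ T (+-monoʳ-≤ O′ (+-monoʳ-≤ (d y) ([b≡?y]≤cost {m = m} b↝m y))) ⟩
    (O′ + (d y + cost m y)) + T   ≡⟨ regroup₁ O′ (d y) (cost m y) T ⟩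
    (cost m y + O′) + (d y + T)   ≤⟨ Balanced-─ bal m∈M y ⟩
    p y + (T + I′)                ≡⟨ regroup₂ (p y) T I′ ⟩
    (p y + I′) + T                ∎)
    where
      open ≤-Reasoning
      O′ = consumed (M ─ m∈M) y
      I′ = produced (M ─ m∈M) y
      T  = gain m y
      regroup₁ : ∀ o e c t → (o + (e + c)) + t ≡ (c + o) + (e + t)
      regroup₁ = solve-∀
      regroup₂ : ∀ q t i → q + (t + i) ≡ (q + i) + t
      regroup₂ = solve-∀

  Balanced-─-walk : ∀ {p M d a e ss} → Walk M a e ss → Unique ss → Balanced p M (d +[ a ]) →
                    ∃[ M′ ] Balanced p M′ (d +[ e ]) × M′ ⊆ M × length M′ + length ss ≡ length M
  Balanced-─-walk []                _             bal = _ , bal , ⊆-refl , +-identityʳ _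
  Balanced-─-walk {M = M} {ss = _ ∷ ss} (step m∈M s w) (t∉ss ∷ u) bal
    with Balanced-─-walk (Walk-─ m∈M t∉ss w) u (Balanced-shift m∈M s bal)
  ... | M′ , bal′ , M′⊆ , len =
    M′ , bal′ , ⊆-trans M′⊆ (─-⊆ m∈M) ,
    trans (+-suc (length M′) (length ss)) (trans (cong suc len) (sym (length-removeAt′ M (index m∈M))))

  Balanced-+[]⁺ : ∀ {p M d} t → Balanced p M d → Balanced (p +[ t ]) M (d +[ t ])
  Balanced-+[]⁺ {p} {M} {d} t bal y =
    subst₂ _≤_ (+-assoc (consumed M y) (d y) _) (xy∙z≈xz∙y (p y) (produced M y) _) (+-monoˡ-≤ _ (bal y))

  Balanced-+[]⁻ : ∀ {p M d} t → Balanced (p +[ t ]) M (d +[ t ]) → Balanced p M d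
  Balanced-+[]⁻ {p} {M} {d} t bal y = +-cancelʳ-≤ _ _ _
    (subst₂ _≤_ (sym (+-assoc (consumed M y) (d y) _)) (xy∙z≈xz∙y (p y) _ (produced M y)) (bal y))

  -- Lend one pebble at t, pass the unit of demand it creates around the cycle
  -- back to t, and return the pebble.
  Balanced-─-cycle : ∀ {p M d} → Cycle M → Balanced p M d →
                     ∃[ M′ ] Balanced p M′ d × M′ ⊆ M × length M′ < length M
  Balanced-─-cycle {p} {M} {d} (t , ss , w , u) bal
    with Balanced-─-walk {p +[ t ]} {M} {d} w u (Balanced-+[]⁺ {p} {M} {d} t bal)
  ... | M′ , bal′ , M′⊆M , len =
    M′ , Balanced-+[]⁻ {p} {M′} {d} t bal′ , M′⊆M , subst (length M′ <_) len (m<m+n _ z<s)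

  walk-upto : ∀ {M b e ss a} → Walk M b e ss → Unique (e ∷ ss) → a ∈ e ∷ ss →
              ∃[ ss₁ ] Walk M b a ss₁ × Unique (a ∷ ss₁) × ss₁ ⊆ ss
  walk-upto w u (here refl) = _ , w , u , ⊆-refl
  walk-upto (step m∈M s w) _ (there (here refl)) = [] , [] , [] ∷ [] , λ ()
  walk-upto {ss = b ∷ ss} (step m∈M s w) ((_ ∷ e∉ss) ∷ b∉ss ∷ u) (there (there a∈ss))
    with walk-upto w (e∉ss ∷ u) (there a∈ss)
  ... | ss₁ , w₁ , a∉ss₁ ∷ u₁ , ss₁⊆ss =
    b ∷ ss₁ , step m∈M s w₁ ,
    (≢-sym (All.lookup b∉ss a∈ss) ∷ a∉ss₁) ∷ All-resp-⊇ ss₁⊆ss b∉ss ∷ u₁ ,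
    ∷⁺ʳ b ss₁⊆ss

  -- Without sinks, a move drawing from b feeds a vertex that is drawn from in
  -- turn, so extending a simple walk must eventually revisit a vertex.
  module _ {M : List (Move G)} (no-sink : All (λ m → consumed M (tgt m) > 0) M) where

    cycle-from : (budget : ℕ) → ∀ {b e ss} → Walk M b e ss → Unique (e ∷ ss) →
                 consumed M b > 0 → n < length (e ∷ ss) + budget → Cycle M
    cycle-from zero {ss = ss} _ u _ n< =
      contradiction (unique⇒length≤ u) (<⇒≱ (subst (n <_) (+-identityʳ _) n<))
    cycle-from (suc budget) {b} {e} {ss} w u b-drawn n< with consumed⇒source M b b-drawn
    ... | m , m∈M , s with tgt m ∈? e ∷ ss
    ...   | yes a∈ with walk-upto w u a∈
    ...     | ss₁ , w₁ , u₁ , _ = tgt m , ss₁ , step m∈M s w₁ , u₁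
    cycle-from (suc budget) {b} {e} {ss} w (e∉ss ∷ u) b-drawn n< | m , m∈M , s | no a∉
      with ¬Any⇒All¬ (e ∷ ss) a∉
    ...   | a≢e ∷ a∉ss =
      cycle-from budget (step m∈M s w) ((≢-sym a≢e ∷ e∉ss) ∷ a∉ss ∷ u)
        (All.lookup no-sink m∈M) (subst (n <_) (+-suc (length (e ∷ ss)) budget) n<)

    find-cycle : ∀ {m} → m ∈ M → Cycle M
    find-cycle m∈M = cycle-from n [] ([] ∷ []) (All.lookup no-sink m∈M) ≤-refl

  schedule : ∀ {p} M d → Acc _<_ (length M) → Balanced p M d → Schedule p M d
  schedule {p} [] d _ bal = [] , p , done , [] , (λ y → subst (d y ≤_) (+-identityʳ (p y)) (bal y)) , []
  schedule {p} M@(_ ∷ _) d (acc smaller) bal with any? (λ m → consumed M (tgt m) ℕ.≟ 0) M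
  ... | yes has-sink with find has-sink
  ...   | m , m∈M , sink =
    Schedule-snoc m∈M sink
      (schedule (M ─ m∈M) _ (smaller (length-─ m∈M)) (Balanced-─-sink {p} {M} {d} m∈M sink bal))
  schedule {p} M@(_ ∷ _) d (acc smaller) bal | no no-sink
    with Balanced-─-cycle {p} {M} {d} (find-cycle (All.map n≢0⇒n>0 (¬Any⇒All¬ M no-sink)) (here refl)) bal
  ... | M′ , bal′ , M′⊆M , shorter = Schedule-⊆ M′⊆M (schedule M′ d (smaller shorter) bal′)

mainTheorem5 : {n : ℕ} (G : Graph n) (p : Distribution n) (x : Fin n) →
    Reachable G p x →
    ∃[ ms ] ∃[ q ] (Runs {G = G} p ms q × NoReversal ms × q x > 0)
mainTheorem5 G p x (ms , q , run , qx>0)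
  with schedule ms _ (<-wellFounded _) (Runs⇒Balanced {x = x} run qx>0)
... | ms′ , q′ , run′ , noRev , δx≤q′ , _ =
  ms′ , q′ , run′ , noRev , subst (_≤ q′ x) ([x≡?x]≡1 x) (δx≤q′ x)
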